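{- Let $\ell\ge1$, $0\le k\le\ell$, $B=(b_1,\dots,b_\ell)$ with integers $b_i\ge2$. Let $w\in V_{\ell,k;B}$ and $v',v''\in\Gamma_B$, and put $A_3=\overline G_{v'}\cap\overline G_{v''}$, $A_2=G_{v''}\setminus G_{v'}$, $A_1=G_{v'}\setminus G_{v''}$, $A_0=G_{v'}\cap G_{v''}$. (i) If $\nu_B(w,v')\nu_B(w,v'')\ne0$, then $G_w\subseteq A_0$. (ii) If $G_w\subseteq A_0$, then $\nu_B(w,v')\nu_B(w,v'')=p_3p_2p_1p_0$, where $p_0=\prod_{i\in G_w}b_i^2$, $p_1=\prod_{i\in A_1}\nu_i(w_i,v''_i)$, $p_2=\prod_{i\in A_2}\nu_i(w_i,v'_i)$, $p_3=\prod_{i\in A_3}\nu_i(w_i,v'_i)\nu_i(w_i,v''_i)$.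
   Context: For an integer $b\ge2$ let $\Sigma_b=\{0,\dots,b-1\}$, $\Delta_b=\Sigma_b\cup\{g\}$ ($g$ a gap symbol), $\Gamma_b=\Delta_b\setminus\{0\}$; $\Delta_B=\prod_i\Delta_{b_i}$, $\Gamma_B=\prod_i\Gamma_{b_i}$, elements written as words. For $v\in\Delta_B$, $G_v=\{i:v_i=g\}$, $\overline G_v=\{1,\dots,\ell\}\setminus G_v$. $V_{\ell,k;B}=\{v\in\Delta_B:|G_v|=\ell-k\}$. On $\Delta_{b_i}$ use the order $0\prec1\prec\cdots\prec b_i-1\prec g$ and define $\nu_i(x,y)=-b_i$ if $x=y=g$; $-y$ if $x=y\ne g$; $1$ if $x\prec y$; $0$ if $x\succ y$. $\nu_B(x,y)=\prod_{i=1}^\ell\nu_i(x_i,y_i)$. -}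

module Defs where

open import Data.Nat using (ℕ; zero; suc)
open import Data.Fin using (Fin; zero; suc; toℕ; _<_)
open import Data.Fin.Properties using (_<?_)
open import Data.Maybe using (Maybe; just; nothing)
open import Data.Integer using (ℤ; +_; -_; _*_)
open import Data.Bool using (Bool; true; false; if_then_else_)
open import Relation.Nullary using (Dec; yes; no; ¬_)
open import Relation.Nullary.Decidable using (⌊_⌋)
open import Relation.Binary.PropositionalEquality using (_≡_)
open import Data.Vec.Functional using (Vector)
open import Data.Fin.Subset using (Subset; ∁)
import Data.Vec as V

-- Δ_b = Σ_b ∪ {g}; the gap symbol g is represented by 'nothing'.
Δ : ℕ → Set
Δ b = Maybe (Fin b)

g : ∀ {b} → Δ b
g = nothing

ΔB : ∀ {ℓ} → (Fin ℓ → ℕ) → Set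
ΔB {ℓ} B = (i : Fin ℓ) → Δ (B i)

InΓ : ∀ {b} → Δ b → Set
InΓ {b} x = ∀ (z : Fin b) → toℕ z ≡ 0 → ¬ (x ≡ just z)

InΓB : ∀ {ℓ} {B : Fin ℓ → ℕ} → ΔB B → Set
InΓB v = ∀ i → InΓ (v i)

isGap : ∀ {b} → Δ b → Bool
isGap nothing  = true
isGap (just _) = false

G : ∀ {ℓ} {B : Fin ℓ → ℕ} → ΔB B → Subset ℓ
G v = V.tabulate (λ i → isGap (v i))

Gbar : ∀ {ℓ} {B : Fin ℓ → ℕ} → ΔB B → Subset ℓ
Gbar v = ∁ (G v)

countTrue : ∀ {n} → Subset n → ℕ
countTrue V.[] = 0
countTrue (true V.∷ s) = suc (countTrue s)
countTrue (false V.∷ s) = countTrue s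

-- v ∈ V_{ℓ,k;B}  iff  |G_v| = ℓ - k   (stated as k + |G_v| = ℓ, with k ≤ ℓ)
InV : ∀ {ℓ} (k : ℕ) {B : Fin ℓ → ℕ} → ΔB B → Set
InV {ℓ} k v = k Data.Nat.+ countTrue (G v) ≡ ℓ

-- ν_i(x,y) for letters in Δ_b with order 0 ≺ 1 ≺ … ≺ b-1 ≺ g
ν : ∀ (b : ℕ) → Δ b → Δ b → ℤ
ν b nothing  nothing  = - (+ b)
ν b nothing  (just y) = + 0
ν b (just x) nothing  = + 1
ν b (just x) (just y) with x <? y | y <? x
... | yes _ | _     = + 1
... | no _  | yes _ = + 0
... | no _  | no _  = - (+ toℕ y)

∏ : ∀ {ℓ} → (Fin ℓ → ℤ) → ℤ
∏ {zero}  f = + 1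
∏ {suc ℓ} f = f zero * ∏ (λ i → f (suc i))

∏∈ : ∀ {ℓ} → Subset ℓ → (Fin ℓ → ℤ) → ℤ
∏∈ S f = ∏ (λ i → if V.lookup S i then f i else + 1)

νB : ∀ {ℓ} (B : Fin ℓ → ℕ) → ΔB B → ΔB B → ℤ
νB B x y = ∏ (λ i → ν (B i) (x i) (y i))

-- Everything is position by position.  At a gap of w the letter g is larger than every digit,
-- so ν_i(g, y) = 0 unless y = g as well, which gives (i).  Under the hypothesis of (ii) each
-- position of ν_B(w,v′) ν_B(w,v″) = ∏ᵢ ν_i(w_i,v′_i) ν_i(w_i,v″_i) lies in exactly one of
-- A₃, A₂, A₁, A₀, and its factor is the one prescribed there: in A₂ resp. A₁ one of the two
-- ν_i has a non-gap w_i against a gap and equals 1, and at a gap of w it is (−b_i)² = b_i².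
module Submission where

open import Defs
open import Data.Nat using (ℕ; _≤_; zero; suc)
open import Data.Fin using (Fin; zero; suc)
open import Data.Fin.Subset using (Subset; ∁; _∈_; _⊆_; _∩_)
open import Data.Fin.Subset.Properties using (x∈p∩q⁺; x∈p∩q⁻)
open import Data.Integer using (ℤ; +_; -_; _*_)
open import Data.Integer.Properties using (*-1-commutativeMonoid; *-zeroˡ; *-zeroʳ)
open import Data.Integer.Tactic.RingSolver using (solve-∀)
open import Data.Bool using (true; not; _∧_; if_then_else_)
open import Data.Maybe using (just; nothing)
open import Data.Product using (_×_; _,_)
open import Data.Vec using (lookup)
open import Data.Vec.Properties using (lookup∘tabulate; lookup-zipWith; lookup-map; []=⇒lookup; lookup⇒[]=)
open import Relation.Nullary using (¬_)
open import Relation.Binary.PropositionalEquality using (_≡_; _≗_; refl; sym; trans; cong; cong₂; module ≡-Reasoning)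
open import Algebra.Properties.CommutativeMonoid.Sum *-1-commutativeMonoid using (sum; sum-cong-≗; ∑-distrib-+)

∏≡sum : ∀ {n} (f : Fin n → ℤ) → ∏ f ≡ sum f
∏≡sum {zero}  f = refl
∏≡sum {suc n} f = cong (f zero *_) (∏≡sum (λ i → f (suc i)))

∏-cong : ∀ {n} {f h : Fin n → ℤ} → f ≗ h → ∏ f ≡ ∏ h
∏-cong {f = f} {h} f≗h = trans (∏≡sum f) (trans (sum-cong-≗ f≗h) (sym (∏≡sum h)))

∏-distrib-* : ∀ {n} (f h : Fin n → ℤ) → ∏ (λ i → f i * h i) ≡ ∏ f * ∏ h
∏-distrib-* f h = trans (∏≡sum (λ i → f i * h i))
  (trans (∑-distrib-+ f h) (sym (cong₂ _*_ (∏≡sum f) (∏≡sum h))))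

∏-zero : ∀ {n} (f : Fin n → ℤ) i → f i ≡ + 0 → ∏ f ≡ + 0
∏-zero f zero    fi≡0 = trans (cong (_* ∏ (λ j → f (suc j))) fi≡0) (*-zeroˡ (∏ (λ j → f (suc j))))
∏-zero f (suc i) fi≡0 = trans (cong (f zero *_) (∏-zero (λ j → f (suc j)) i fi≡0)) (*-zeroʳ (f zero))

∏-nonzero⇒nonzero : ∀ {n} (f : Fin n → ℤ) → ¬ ∏ f ≡ + 0 → ∀ i → ¬ f i ≡ + 0
∏-nonzero⇒nonzero f ∏f≢0 i fi≡0 = ∏f≢0 (∏-zero f i fi≡0)

*-nonzero⇒nonzero : ∀ {x y : ℤ} → ¬ x * y ≡ + 0 → ¬ x ≡ + 0 × ¬ y ≡ + 0
*-nonzero⇒nonzero {x} {y} xy≢0 =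
  (λ x≡0 → xy≢0 (trans (cong (_* y) x≡0) (*-zeroˡ y))) ,
  (λ y≡0 → xy≢0 (trans (cong (x *_) y≡0) (*-zeroʳ x)))

ν-nonzero-at-gap : ∀ b (x y : Δ b) → isGap x ≡ true → ¬ ν b x y ≡ + 0 → isGap y ≡ true
ν-nonzero-at-gap b nothing nothing  _ _   = refl
ν-nonzero-at-gap b nothing (just _) _ ν≢0 with ν≢0 refl
... | ()

ν*ν-factorises : ∀ b (x y z : Δ b) → (isGap x ≡ true → isGap y ∧ isGap z ≡ true) →
  ν b x y * ν b x z ≡
    (if not (isGap y) ∧ not (isGap z) then ν b x y * ν b x z else + 1)
  * (if isGap z ∧ not (isGap y) then ν b x y else + 1)
  * (if isGap y ∧ not (isGap z) then ν b x z else + 1)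
  * (if isGap x then + b * + b else + 1)
ν*ν-factorises b nothing  nothing  nothing  _    = square-of-neg (+ b)
  where
  square-of-neg : ∀ t → - t * - t ≡ + 1 * + 1 * + 1 * (t * t)
  square-of-neg = solve-∀
ν*ν-factorises b nothing  nothing  (just _) gaps with gaps refl
... | ()
ν*ν-factorises b nothing  (just _) _        gaps with gaps refl
... | ()
ν*ν-factorises b (just x) nothing  nothing  _    = refl
ν*ν-factorises b (just x) nothing  (just z) _    = only-second (ν b (just x) (just z))
  where
  only-second : ∀ t → + 1 * t ≡ + 1 * + 1 * t * + 1
  only-second = solve-∀
ν*ν-factorises b (just x) (just y) nothing  _    = only-first (ν b (just x) (just y))
  where
  only-first : ∀ t → t * + 1 ≡ + 1 * t * + 1 * + 1
  only-first = solve-∀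
ν*ν-factorises b (just x) (just y) (just z) _    = both (ν b (just x) (just y)) (ν b (just x) (just z))
  where
  both : ∀ t u → t * u ≡ t * u * + 1 * + 1 * + 1
  both = solve-∀

module _ {ℓ} {B : Fin ℓ → ℕ} where

  lookup-G : (v : ΔB B) → ∀ i → lookup (G v) i ≡ isGap (v i)
  lookup-G v = lookup∘tabulate (λ i → isGap (v i))

  lookup-∩ : (S T : Subset ℓ) → ∀ i → lookup (S ∩ T) i ≡ lookup S i ∧ lookup T i
  lookup-∩ S T i = lookup-zipWith _∧_ i S T

  lookup-∁ : (S : Subset ℓ) → ∀ i → lookup (∁ S) i ≡ not (lookup S i)
  lookup-∁ S i = lookup-map i not S

  ∈G⇒gap : (v : ΔB B) → ∀ {i} → i ∈ G v → isGap (v i) ≡ true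
  ∈G⇒gap v {i} i∈G = trans (sym (lookup-G v i)) ([]=⇒lookup i∈G)

  gap⇒∈G : (v : ΔB B) → ∀ {i} → isGap (v i) ≡ true → i ∈ G v
  gap⇒∈G v {i} gap = lookup⇒[]= i (G v) (trans (lookup-G v i) gap)

  νB-nonzero⇒gaps⊆gaps : (w v : ΔB B) → ¬ νB B w v ≡ + 0 → G w ⊆ G v
  νB-nonzero⇒gaps⊆gaps w v νB≢0 {i} i∈Gw = gap⇒∈G v
    (ν-nonzero-at-gap (B i) (w i) (v i) (∈G⇒gap w i∈Gw)
      (∏-nonzero⇒nonzero _ νB≢0 i))

  νB*νB-nonzero⇒gaps⊆gaps : (w v′ v″ : ΔB B) →
    ¬ (νB B w v′ * νB B w v″ ≡ + 0) → G w ⊆ (G v′ ∩ G v″)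
  νB*νB-nonzero⇒gaps⊆gaps w v′ v″ ν≢0 i∈Gw =
    let ν′≢0 , ν″≢0 = *-nonzero⇒nonzero ν≢0 in
    x∈p∩q⁺ (νB-nonzero⇒gaps⊆gaps w v′ ν′≢0 i∈Gw , νB-nonzero⇒gaps⊆gaps w v″ ν″≢0 i∈Gw)

  νB*νB-factorises : (w v′ v″ : ΔB B) → G w ⊆ (G v′ ∩ G v″)
    → νB B w v′ * νB B w v″
      ≡ ∏∈ (Gbar v′ ∩ Gbar v″) (λ i → ν (B i) (w i) (v′ i) * ν (B i) (w i) (v″ i))
        * ∏∈ (G v″ ∩ Gbar v′) (λ i → ν (B i) (w i) (v′ i))
        * ∏∈ (G v′ ∩ Gbar v″) (λ i → ν (B i) (w i) (v″ i))
        * ∏∈ (G w) (λ i → + (B i) * + (B i))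
  νB*νB-factorises w v′ v″ Gw⊆ = begin
    νB B w v′ * νB B w v″                ≡⟨ ∏-distrib-* f′ f″ ⟨
    ∏ (λ i → f′ i * f″ i)                ≡⟨ ∏-cong pointwise ⟩
    ∏ (λ i → c₃ i * c₂ i * c₁ i * c₀ i)  ≡⟨ ∏-distrib-* (λ i → c₃ i * c₂ i * c₁ i) c₀ ⟩
    ∏ (λ i → c₃ i * c₂ i * c₁ i) * ∏ c₀  ≡⟨ cong (_* ∏ c₀) (∏-distrib-* (λ i → c₃ i * c₂ i) c₁) ⟩
    ∏ (λ i → c₃ i * c₂ i) * ∏ c₁ * ∏ c₀  ≡⟨ cong (λ t → t * ∏ c₁ * ∏ c₀) (∏-distrib-* c₃ c₂) ⟩
    ∏ c₃ * ∏ c₂ * ∏ c₁ * ∏ c₀            ∎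
    where
    open ≡-Reasoning
    f′ f″ c₃ c₂ c₁ c₀ : Fin ℓ → ℤ
    f′ i = ν (B i) (w i) (v′ i)
    f″ i = ν (B i) (w i) (v″ i)
    c₃ i = if lookup (Gbar v′ ∩ Gbar v″) i then f′ i * f″ i else + 1
    c₂ i = if lookup (G v″ ∩ Gbar v′) i then f′ i else + 1
    c₁ i = if lookup (G v′ ∩ Gbar v″) i then f″ i else + 1
    c₀ i = if lookup (G w) i then + (B i) * + (B i) else + 1

    gap-inherited : ∀ i → isGap (w i) ≡ true → isGap (v′ i) ∧ isGap (v″ i) ≡ true
    gap-inherited i gap with x∈p∩q⁻ (G v′) (G v″) (Gw⊆ (gap⇒∈G w gap))
    ... | i∈Gv′ , i∈Gv″ = cong₂ _∧_ (∈G⇒gap v′ i∈Gv′) (∈G⇒gap v″ i∈Gv″)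

    pointwise : ∀ i → f′ i * f″ i ≡ c₃ i * c₂ i * c₁ i * c₀ i
    pointwise i
      rewrite lookup-∩ (Gbar v′) (Gbar v″) i | lookup-∩ (G v″) (Gbar v′) i
            | lookup-∩ (G v′) (Gbar v″) i | lookup-∁ (G v′) i | lookup-∁ (G v″) i
            | lookup-G v′ i | lookup-G v″ i | lookup-G w i
      = ν*ν-factorises (B i) (w i) (v′ i) (v″ i) (gap-inherited i)

lemma7 : (ℓ : ℕ) → 1 ≤ ℓ → (k : ℕ) → k ≤ ℓ → (B : Fin ℓ → ℕ) → (∀ i → 2 ≤ B i)
    → (w : ΔB B) → InV k w → (v′ v″ : ΔB B) → InΓB v′ → InΓB v″
    → (¬ (νB B w v′ * νB B w v″ ≡ + 0) → G w ⊆ (G v′ ∩ G v″))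
    × (G w ⊆ (G v′ ∩ G v″)
       → νB B w v′ * νB B w v″
         ≡ ∏∈ (Gbar v′ ∩ Gbar v″) (λ i → ν (B i) (w i) (v′ i) * ν (B i) (w i) (v″ i))
           * ∏∈ (G v″ ∩ Gbar v′) (λ i → ν (B i) (w i) (v′ i))
           * ∏∈ (G v′ ∩ Gbar v″) (λ i → ν (B i) (w i) (v″ i))
           * ∏∈ (G w) (λ i → + (B i) * + (B i)))
lemma7 _ _ _ _ _ _ w _ v′ v″ _ _ =
  νB*νB-nonzero⇒gaps⊆gaps w v′ v″ , νB*νB-factorises w v′ v″
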